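{- For all integers $s,t \ge 3$, $\mathsf{DS}(s,t) \ge 2s+2t-7$. Equivalently, every doubly saturated $R(s,t)$-good graph has at least $2s+2t-7$ vertices.
   Context: All graphs are simple and finite. A graph is $R(s,t)$-good if it contains neither a clique on $s$ vertices nor an independent set of $t$ vertices. A graph $G$ is doubly saturated $R(s,t)$-good if (i) $G$ is $R(s,t)$-good, (ii) adding any edge to $G$ yields a graph that is not $R(s,t)$-good, (iii) removing any edge from $G$ yields a graph that is not $R(s,t)$-good, and (iv) neither $G$ nor its complement $\overline{G}$ is a complete graph. The double saturation number is $\mathsf{DS}(s,t) := \inf\{n : \text{there is a doubly saturated } R(s,t)\text{ -good graph on } n \text{ vertices}\}$ (with $\inf \emptyset = \infty$). -}

module Defs where

open import Data.Nat using (ℕ)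
open import Data.Fin using (Fin)
open import Data.Bool using (Bool; true; false)
open import Data.Product using (Σ; ∃; ∃₂; _×_; _,_)
open import Data.Sum using (_⊎_)
open import Relation.Binary.PropositionalEquality using (_≡_; _≢_)
open import Relation.Nullary using (¬_)
open import Function.Definitions using (Injective)

record Graph (n : ℕ) : Set where
  field
    adj    : Fin n → Fin n → Bool
    sym    : ∀ u v → adj u v ≡ adj v u
    irrefl : ∀ v → adj v v ≡ false
open Graph public

HasClique : ∀ {n} → Graph n → ℕ → Set
HasClique {n} G k = Σ (Fin k → Fin n) λ f →
  Injective _≡_ _≡_ f × (∀ i j → i ≢ j → adj G (f i) (f j) ≡ true)

HasIndep : ∀ {n} → Graph n → ℕ → Set
HasIndep {n} G k = Σ (Fin k → Fin n) λ f →
  Injective _≡_ _≡_ f × (∀ i j → i ≢ j → adj G (f i) (f j) ≡ false)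

RGood : ∀ {n} → ℕ → ℕ → Graph n → Set
RGood s t G = ¬ HasClique G s × ¬ HasIndep G t

SamePair : ∀ {n} → Fin n → Fin n → Fin n → Fin n → Set
SamePair x y u v = (x ≡ u × y ≡ v) ⊎ (x ≡ v × y ≡ u)

-- H is obtained from G by setting the adjacency of the pair {u,v} to b and
-- leaving every other pair unchanged.  (With b = true and uv a non-edge of G
-- this is "G + uv"; with b = false and uv an edge this is "G - uv".)
-- Such an H is unique when it exists.
Flip : ∀ {n} → Graph n → Graph n → Fin n → Fin n → Bool → Set
Flip G H u v b =
  adj H u v ≡ b × (∀ x y → ¬ SamePair x y u v → adj H x y ≡ adj G x y)

Complete : ∀ {n} → Graph n → Set
Complete {n} G = ∀ (u v : Fin n) → u ≢ v → adj G u v ≡ true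

ComplementComplete : ∀ {n} → Graph n → Set
ComplementComplete {n} G = ∀ (u v : Fin n) → u ≢ v → adj G u v ≡ false

record DoublySaturated {n : ℕ} (s t : ℕ) (G : Graph n) : Set where
  field
    good        : RGood s t G
    addSat      : ∀ (u v : Fin n) → u ≢ v → adj G u v ≡ false →
                  ∀ (H : Graph n) → Flip G H u v true → ¬ RGood s t H
    removeSat   : ∀ (u v : Fin n) → adj G u v ≡ true →
                  ∀ (H : Graph n) → Flip G H u v false → ¬ RGood s t H
    notComplete : ¬ Complete G
    notEmpty    : ¬ ComplementComplete G

-- Colour each pair of vertices by its adjacency, write N_b(v) for the vertices joined to v
-- in colour b, and k_b for s (b = true) or t (b = false).  By saturation, recolouring a pair
-- uw of colour ¬b to b creates a b-homogeneous k_b-set; it must contain u and w, and the rest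
-- is a b-homogeneous set of k_b − 2 common b-neighbours of u and w.  As G is R(s,t)-good, no
-- b-homogeneous subset of N_b(v) has more than k_b − 2 vertices (with v it would form a
-- forbidden set).  So every x ∈ N_¬b(v) yields a maximum b-homogeneous set T_x ⊆ N_b(v)
-- joined to x in colour b, while recolouring vz for z ∈ N_b(v) yields an x ∈ N_¬b(v) with xz
-- of colour ¬b, so that z ∉ T_x: the T_x have empty intersection.  Hajnal's lemma (for
-- maximum homogeneous sets, |⋂| + |⋃| is at least twice the maximum size) then gives
-- |N_b(v)| ≥ 2(k_b − 2) whenever N_¬b(v) is non-empty.  An endpoint v of a non-edge has a
-- non-neighbour, hence also a neighbour, and n ≥ 1 + 2(s − 2) + 2(t − 2) = 2s + 2t − 7.

module Submission where

open import Data.Bool using (Bool; true; false; not; if_then_else_)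
import Data.Bool.Properties as Bool
open import Data.Fin using (Fin; zero; suc; inject≤; _≟_)
open import Data.Fin.Properties using (inject≤-injective; injective⇒≤; any?; all?; suc-injective)
open import Data.Fin.Subset
open import Data.Fin.Subset.Properties
open import Data.List using (List; []; _∷_; map; allFin)
open import Data.List.Membership.Propositional.Properties using (∈-allFin)
open import Data.List.Relation.Unary.All as All using (All; []; _∷_)
import Data.List.Relation.Unary.All.Properties as All
import Data.List.Relation.Unary.Any as Any
open import Data.Nat using (ℕ; suc; _≤_; _<_; _+_; _*_; _∸_; s≤s; _≤?_)
open import Data.Nat.Properties
  using (+-suc; +-identityʳ; +-assoc; +-mono-≤; +-monoʳ-≤; +-cancelʳ-≤; ∸-monoˡ-≤; m+n∸m≡n; ≰⇒>;
         ≤-refl; ≤-trans; module ≤-Reasoning)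
open import Data.Nat.Tactic.RingSolver using (solve-∀)
open import Data.Product using (Σ; ∃; _×_; _,_; proj₁; proj₂)
open import Data.Sum using (inj₁; inj₂; [_,_]′)
open import Data.Vec using (_∷_; []; tabulate; here; there)
open import Data.Vec.Properties using (lookup∘tabulate; lookup⇒[]=; []=⇒lookup)
open import Function using (_∘_; mk⇔)
open import Function.Definitions using (Injective)
open import Relation.Binary.PropositionalEquality
  using (_≡_; _≢_; refl; sym; trans; cong; cong₂; subst; subst₂; module ≡-Reasoning)
open import Relation.Nullary using (¬_; Dec; yes; no; does; contradiction)
open import Relation.Nullary.Decidable
  using (dec-true; dec-false; does-⇔; map′; ¬?; _×-dec_; _⊎-dec_; _→-dec_; decidable-stable)
open import Relation.Unary using (Pred; Decidable)

open import Defs renaming (sym to adj-sym)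

∣p∣≡∣p∩q∣+∣p∩∁q∣ : ∀ {n} (p q : Subset n) → ∣ p ∣ ≡ ∣ p ∩ q ∣ + ∣ p ∩ ∁ q ∣
∣p∣≡∣p∩q∣+∣p∩∁q∣ []            []            = refl
∣p∣≡∣p∩q∣+∣p∩∁q∣ (inside  ∷ p) (inside  ∷ q) = cong suc (∣p∣≡∣p∩q∣+∣p∩∁q∣ p q)
∣p∣≡∣p∩q∣+∣p∩∁q∣ (inside  ∷ p) (outside ∷ q) =
  trans (cong suc (∣p∣≡∣p∩q∣+∣p∩∁q∣ p q)) (sym (+-suc _ _))
∣p∣≡∣p∩q∣+∣p∩∁q∣ (outside ∷ p) (_       ∷ q) = ∣p∣≡∣p∩q∣+∣p∩∁q∣ p q

∣p∪q∣+∣p∩q∣≡∣p∣+∣q∣ : ∀ {n} (p q : Subset n) → ∣ p ∪ q ∣ + ∣ p ∩ q ∣ ≡ ∣ p ∣ + ∣ q ∣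
∣p∪q∣+∣p∩q∣≡∣p∣+∣q∣ []            []            = refl
∣p∪q∣+∣p∩q∣≡∣p∣+∣q∣ (inside  ∷ p) (inside  ∷ q) =
  cong suc (trans (+-suc _ _) (trans (cong suc (∣p∪q∣+∣p∩q∣≡∣p∣+∣q∣ p q)) (sym (+-suc _ _))))
∣p∪q∣+∣p∩q∣≡∣p∣+∣q∣ (inside  ∷ p) (outside ∷ q) = cong suc (∣p∪q∣+∣p∩q∣≡∣p∣+∣q∣ p q)
∣p∪q∣+∣p∩q∣≡∣p∣+∣q∣ (outside ∷ p) (inside  ∷ q) =
  trans (cong suc (∣p∪q∣+∣p∩q∣≡∣p∣+∣q∣ p q)) (sym (+-suc _ _))
∣p∪q∣+∣p∩q∣≡∣p∣+∣q∣ (outside ∷ p) (outside ∷ q) = ∣p∪q∣+∣p∩q∣≡∣p∣+∣q∣ p q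

Disjoint : ∀ {n} → Subset n → Subset n → Set
Disjoint p q = ∀ {x} → x ∈ p → x ∉ q

Empty⇒∣p∣≡0 : ∀ {n} {p : Subset n} → Empty p → ∣ p ∣ ≡ 0
Empty⇒∣p∣≡0 {n} empty = trans (cong ∣_∣ (Empty-unique empty)) (∣⊥∣≡0 n)

disjoint⇒∣p∪q∣≡∣p∣+∣q∣ : ∀ {n} (p q : Subset n) → Disjoint p q → ∣ p ∪ q ∣ ≡ ∣ p ∣ + ∣ q ∣
disjoint⇒∣p∪q∣≡∣p∣+∣q∣ p q p∩q=∅ = begin
  ∣ p ∪ q ∣               ≡⟨ +-identityʳ _ ⟨
  ∣ p ∪ q ∣ + 0           ≡⟨ cong (∣ p ∪ q ∣ +_) (Empty⇒∣p∣≡0 empty) ⟨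
  ∣ p ∪ q ∣ + ∣ p ∩ q ∣   ≡⟨ ∣p∪q∣+∣p∩q∣≡∣p∣+∣q∣ p q ⟩
  ∣ p ∣ + ∣ q ∣           ∎
  where
  open ≡-Reasoning
  empty : Empty (p ∩ q)
  empty (x , x∈p∩q) = let x∈p , x∈q = x∈p∩q⁻ p q x∈p∩q in p∩q=∅ x∈p x∈q

∣p∣≤1+∣p∩∁⁅x⁆∣ : ∀ {n} (p : Subset n) (x : Fin n) → ∣ p ∣ ≤ 1 + ∣ p ∩ ∁ ⁅ x ⁆ ∣
∣p∣≤1+∣p∩∁⁅x⁆∣ p x = begin
  ∣ p ∣                           ≡⟨ ∣p∣≡∣p∩q∣+∣p∩∁q∣ p ⁅ x ⁆ ⟩
  ∣ p ∩ ⁅ x ⁆ ∣ + ∣ p ∩ ∁ ⁅ x ⁆ ∣ ≤⟨ +-mono-≤ (∣p∩q∣≤∣q∣ p ⁅ x ⁆) ≤-refl ⟩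
  ∣ ⁅ x ⁆ ∣ + ∣ p ∩ ∁ ⁅ x ⁆ ∣     ≡⟨ cong (_+ ∣ p ∩ ∁ ⁅ x ⁆ ∣) (∣⁅x⁆∣≡1 x) ⟩
  1 + ∣ p ∩ ∁ ⁅ x ⁆ ∣             ∎
  where open ≤-Reasoning

0<∣p∣⇒Nonempty : ∀ {n} (p : Subset n) → 0 < ∣ p ∣ → Nonempty p
0<∣p∣⇒Nonempty p 0<∣p∣ = decidable-stable (nonempty? p) λ empty →
  contradiction (subst (0 <_) (Empty⇒∣p∣≡0 empty) 0<∣p∣) λ ()

∈⋂⁻ : ∀ {n} {x : Fin n} (Ss : List (Subset n)) → x ∈ ⋂ Ss → All (x ∈_) Ss
∈⋂⁻ []       _       = []
∈⋂⁻ (S ∷ Ss) x∈S∩⋂Ss = let x∈S , x∈⋂Ss = x∈p∩q⁻ S (⋂ Ss) x∈S∩⋂Ss in x∈S ∷ ∈⋂⁻ Ss x∈⋂Ss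

⋃-⊆ : ∀ {n} {R : Subset n} {Ss : List (Subset n)} → All (_⊆ R) Ss → ⋃ Ss ⊆ R
⋃-⊆ []                    = ⊥⊆
⋃-⊆ {Ss = S ∷ Ss} (S⊆R ∷ Ss⊆R) x∈S∪⋃Ss with x∈p∪q⁻ S (⋃ Ss) x∈S∪⋃Ss
... | inj₁ x∈S   = S⊆R x∈S
... | inj₂ x∈⋃Ss = ⋃-⊆ Ss⊆R x∈⋃Ss

select : ∀ {n ℓ} {P : Pred (Fin n) ℓ} → Decidable P → Subset n
select P? = tabulate (does ∘ P?)

module _ {n ℓ} {P : Pred (Fin n) ℓ} (P? : Decidable P) where

  ∈select⁺ : ∀ {x} → P x → x ∈ select P?
  ∈select⁺ {x} px = lookup⇒[]= x _ (trans (lookup∘tabulate (does ∘ P?) x) (dec-true (P? x) px))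

  ∈select⁻ : ∀ {x} → x ∈ select P? → P x
  ∈select⁻ {x} x∈ with P? x | trans (sym (lookup∘tabulate (does ∘ P?) x)) ([]=⇒lookup x∈)
  ... | yes px | _  = px
  ... | no  _  | ()

rank : ∀ {n} {p : Subset n} {x} → x ∈ p → Fin ∣ p ∣
rank {p = inside  ∷ p} here        = zero
rank {p = inside  ∷ p} (there x∈p) = suc (rank x∈p)
rank {p = outside ∷ p} (there x∈p) = rank x∈p

rank-injective : ∀ {n} {p : Subset n} {x y} (x∈p : x ∈ p) (y∈p : y ∈ p) →
                 rank x∈p ≡ rank y∈p → x ≡ y
rank-injective {p = inside  ∷ p} here        here        _ = refl
rank-injective {p = inside  ∷ p} (there x∈p) (there y∈p) r≡r =
  cong suc (rank-injective x∈p y∈p (suc-injective r≡r))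
rank-injective {p = outside ∷ p} (there x∈p) (there y∈p) r≡r =
  cong suc (rank-injective x∈p y∈p r≡r)

enumerate : ∀ {n} (p : Subset n) → Fin ∣ p ∣ → Fin n
enumerate (inside  ∷ p) zero    = zero
enumerate (inside  ∷ p) (suc i) = suc (enumerate p i)
enumerate (outside ∷ p) i       = suc (enumerate p i)

enumerate-∈ : ∀ {n} (p : Subset n) i → enumerate p i ∈ p
enumerate-∈ (inside  ∷ p) zero    = here
enumerate-∈ (inside  ∷ p) (suc i) = there (enumerate-∈ p i)
enumerate-∈ (outside ∷ p) i       = there (enumerate-∈ p i)

enumerate-injective : ∀ {n} (p : Subset n) → Injective _≡_ _≡_ (enumerate p)
enumerate-injective (inside  ∷ p) {zero}  {zero}  _ = refl
enumerate-injective (inside  ∷ p) {suc i} {suc j} e =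
  cong suc (enumerate-injective p (suc-injective e))
enumerate-injective (outside ∷ p) e = enumerate-injective p (suc-injective e)

module _ {m n} (f : Fin m → Fin n) where

  private
    hit? : Decidable λ x → ∃ λ i → f i ≡ x
    hit? x = any? λ i → f i ≟ x

  image : Subset n
  image = select hit?

  ∈image⁺ : ∀ i → f i ∈ image
  ∈image⁺ i = ∈select⁺ hit? (i , refl)

  ∈image⁻ : ∀ {x} → x ∈ image → ∃ λ i → f i ≡ x
  ∈image⁻ = ∈select⁻ hit?

Homogeneous : ∀ {n} → Graph n → Bool → Subset n → Set
Homogeneous G b S = ∀ {x y} → x ∈ S → y ∈ S → x ≢ y → adj G x y ≡ b

HasHomogeneous : ∀ {n} → Graph n → Bool → ℕ → Set
HasHomogeneous {n} G b k = Σ (Fin k → Fin n) λ f →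
  Injective _≡_ _≡_ f × (∀ i j → i ≢ j → adj G (f i) (f j) ≡ b)

HomogeneousSet : ∀ {n} → Graph n → Bool → ℕ → Set
HomogeneousSet G b k = ∃ λ S → k ≤ ∣ S ∣ × Homogeneous G b S

module _ {n} (G : Graph n) (b : Bool) where

  hasHomogeneous⇒homogeneousSet : ∀ {k} → HasHomogeneous G b k → HomogeneousSet G b k
  hasHomogeneous⇒homogeneousSet {k} (f , f-injective , f-homogeneous) =
    image f , k≤∣image∣ , homogeneous
    where
    k≤∣image∣ : k ≤ ∣ image f ∣
    k≤∣image∣ = injective⇒≤ {f = rank ∘ ∈image⁺ f}
      (f-injective ∘ rank-injective (∈image⁺ f _) (∈image⁺ f _))

    homogeneous : Homogeneous G b (image f)
    homogeneous x∈ y∈ x≢y with ∈image⁻ f x∈ | ∈image⁻ f y∈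
    ... | i , refl | j , refl = f-homogeneous i j λ { refl → x≢y refl }

  homogeneousSet⇒hasHomogeneous : ∀ {k} → HomogeneousSet G b k → HasHomogeneous G b k
  homogeneousSet⇒hasHomogeneous {k} (S , k≤∣S∣ , homogeneous) = f , f-injective , f-homogeneous
    where
    f : Fin k → Fin n
    f i = enumerate S (inject≤ i k≤∣S∣)

    f-injective : Injective _≡_ _≡_ f
    f-injective e = inject≤-injective k≤∣S∣ k≤∣S∣ _ _ (enumerate-injective S e)

    f-homogeneous : ∀ i j → i ≢ j → adj G (f i) (f j) ≡ b
    f-homogeneous i j i≢j = homogeneous (enumerate-∈ S _) (enumerate-∈ S _) (i≢j ∘ f-injective)

  homogeneous? : Decidable (Homogeneous G b)
  homogeneous? S = map′ (λ hom {x} {y} → hom x y) (λ hom x y → hom)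
    (all? λ x → all? λ y → x ∈? S →-dec y ∈? S →-dec ¬? (x ≟ y) →-dec adj G x y Bool.≟ b)

  hasHomogeneous? : ∀ k → Dec (HasHomogeneous G b k)
  hasHomogeneous? k = map′ homogeneousSet⇒hasHomogeneous hasHomogeneous⇒homogeneousSet
    (anySubset? λ S → k ≤? ∣ S ∣ ×-dec homogeneous? S)

exchange-≤ : ∀ {x y i d u c s} → x ≡ i + d → u + c ≡ y + s → d + c ≤ s → x + y ≤ i + u
exchange-≤ {x} {y} {i} {d} {u} {c} {s} x≡i+d u+c≡y+s d+c≤s = +-cancelʳ-≤ c (x + y) (i + u) (begin
  x + y + c       ≡⟨ cong (λ x → x + y + c) x≡i+d ⟩
  i + d + y + c   ≡⟨ swap i d y c ⟩
  i + y + (d + c) ≤⟨ +-monoʳ-≤ (i + y) d+c≤s ⟩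
  i + y + s       ≡⟨ +-assoc i y s ⟩
  i + (y + s)     ≡⟨ cong (i +_) u+c≡y+s ⟨
  i + (u + c)     ≡⟨ +-assoc i u c ⟨
  i + u + c       ∎)
  where
  open ≤-Reasoning
  swap : ∀ i d y c → i + d + y + c ≡ i + y + (d + c)
  swap = solve-∀

module Hajnal {n} (G : Graph n) (b : Bool) (R : Subset n) (a : ℕ)
  (bounded : ∀ {I} → I ⊆ R → Homogeneous G b I → ∣ I ∣ ≤ a) where

  Maximum : Subset n → Set
  Maximum S = S ⊆ R × Homogeneous G b S × a ≤ ∣ S ∣

  private
    -- X and Y are the intersection and the union of the sets processed so far.
    record Invariant (X Y : Subset n) : Set where
      field
        X⊆Y      : X ⊆ Y
        Y⊆R      : Y ⊆ R
        complete : ∀ {x y} → x ∈ X → y ∈ Y → x ≢ y → adj G x y ≡ b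
        large    : 2 * a ≤ ∣ X ∣ + ∣ Y ∣

    start : ∀ {S} → Maximum S → Invariant S S
    start {S} (S⊆R , homogeneous , a≤∣S∣) = record
      { X⊆Y = λ x∈S → x∈S ; Y⊆R = S⊆R ; complete = homogeneous
      ; large = +-mono-≤ a≤∣S∣ (subst (_≤ ∣ S ∣) (sym (+-identityʳ a)) a≤∣S∣) }

    step : ∀ {X Y S} → Invariant X Y → Maximum S → Invariant (X ∩ S) (Y ∪ S)
    step {X} {Y} {S} inv (S⊆R , S-homogeneous , a≤∣S∣) = record
      { X⊆Y      = p⊆p∪q S ∘ X⊆Y ∘ proj₁ ∘ x∈p∩q⁻ X S
      ; Y⊆R      = [ Y⊆R , S⊆R ]′ ∘ x∈p∪q⁻ Y S
      ; complete = complete′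
      ; large    = ≤-trans large grows
      }
      where
      open Invariant inv

      complete′ : ∀ {x y} → x ∈ X ∩ S → y ∈ Y ∪ S → x ≢ y → adj G x y ≡ b
      complete′ x∈X∩S y∈Y∪S with x∈p∩q⁻ X S x∈X∩S | x∈p∪q⁻ Y S y∈Y∪S
      ... | x∈X , _   | inj₁ y∈Y = complete x∈X y∈Y
      ... | _   , x∈S | inj₂ y∈S = S-homogeneous x∈S y∈S

      -- I is homogeneous inside R, so |X ∖ S| + |Y ∩ S| ≤ a ≤ |S|: this makes |X| + |Y| grow.
      I : Subset n
      I = (X ∩ ∁ S) ∪ (Y ∩ S)

      I⊆Y : I ⊆ Y
      I⊆Y x∈I with x∈p∪q⁻ (X ∩ ∁ S) (Y ∩ S) x∈I
      ... | inj₁ x∈X∖S = X⊆Y (proj₁ (x∈p∩q⁻ X (∁ S) x∈X∖S))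
      ... | inj₂ x∈Y∩S = proj₁ (x∈p∩q⁻ Y S x∈Y∩S)

      I-homogeneous : Homogeneous G b I
      I-homogeneous {x} {y} x∈I y∈I x≢y
        with x∈p∪q⁻ (X ∩ ∁ S) (Y ∩ S) x∈I | x∈p∪q⁻ (X ∩ ∁ S) (Y ∩ S) y∈I
      ... | inj₁ x∈X∖S | _ = complete (proj₁ (x∈p∩q⁻ X (∁ S) x∈X∖S)) (I⊆Y y∈I) x≢y
      ... | inj₂ x∈Y∩S | inj₁ y∈X∖S =
        trans (adj-sym G x y) (complete (proj₁ (x∈p∩q⁻ X (∁ S) y∈X∖S)) (I⊆Y x∈I) (x≢y ∘ sym))
      ... | inj₂ x∈Y∩S | inj₂ y∈Y∩S =
        S-homogeneous (proj₂ (x∈p∩q⁻ Y S x∈Y∩S)) (proj₂ (x∈p∩q⁻ Y S y∈Y∩S)) x≢y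

      disjoint : Disjoint (X ∩ ∁ S) (Y ∩ S)
      disjoint x∈X∖S x∈Y∩S =
        x∈∁p⇒x∉p (proj₂ (x∈p∩q⁻ X (∁ S) x∈X∖S)) (proj₂ (x∈p∩q⁻ Y S x∈Y∩S))

      ∣X∖S∣+∣Y∩S∣≤∣S∣ : ∣ X ∩ ∁ S ∣ + ∣ Y ∩ S ∣ ≤ ∣ S ∣
      ∣X∖S∣+∣Y∩S∣≤∣S∣ = begin
        ∣ X ∩ ∁ S ∣ + ∣ Y ∩ S ∣ ≡⟨ disjoint⇒∣p∪q∣≡∣p∣+∣q∣ (X ∩ ∁ S) (Y ∩ S) disjoint ⟨
        ∣ I ∣                   ≤⟨ bounded (Y⊆R ∘ I⊆Y) I-homogeneous ⟩
        a                       ≤⟨ a≤∣S∣ ⟩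
        ∣ S ∣                   ∎
        where open ≤-Reasoning

      grows : ∣ X ∣ + ∣ Y ∣ ≤ ∣ X ∩ S ∣ + ∣ Y ∪ S ∣
      grows = exchange-≤ {i = ∣ X ∩ S ∣} {u = ∣ Y ∪ S ∣}
        (∣p∣≡∣p∩q∣+∣p∩∁q∣ X S) (∣p∪q∣+∣p∩q∣≡∣p∣+∣q∣ Y S) ∣X∖S∣+∣Y∩S∣≤∣S∣

    fold : ∀ {X Y} Ss → Invariant X Y → All Maximum Ss → Invariant (X ∩ ⋂ Ss) (Y ∪ ⋃ Ss)
    fold {X} {Y} []       inv [] = subst₂ Invariant (sym (∩-identityʳ X)) (sym (∪-identityʳ Y)) inv
    fold {X} {Y} (S ∷ Ss) inv (S-maximum ∷ Ss-maximum) =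
      subst₂ Invariant (∩-assoc X S (⋂ Ss)) (∪-assoc Y S (⋃ Ss))
        (fold Ss (step inv S-maximum) Ss-maximum)

  hajnal : ∀ {S Ss} → All Maximum (S ∷ Ss) → 2 * a ≤ ∣ ⋂ (S ∷ Ss) ∣ + ∣ ⋃ (S ∷ Ss) ∣
  hajnal {Ss = Ss} (S-maximum ∷ Ss-maximum) = Invariant.large (fold Ss (start S-maximum) Ss-maximum)

module _ {n} (G : Graph n) (b : Bool) (v : Fin n) where

  private
    neighbour? : Decidable λ z → adj G v z ≡ b × z ≢ v
    neighbour? z = adj G v z Bool.≟ b ×-dec ¬? (z ≟ v)

  -- For b = false these are the non-neighbours of v.
  neighbourhood : Subset n
  neighbourhood = select neighbour?

  ∈neighbourhood⁺ : ∀ {z} → adj G v z ≡ b → z ≢ v → z ∈ neighbourhood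
  ∈neighbourhood⁺ vz≡b z≢v = ∈select⁺ neighbour? (vz≡b , z≢v)

  ∈neighbourhood⁻ : ∀ {z} → z ∈ neighbourhood → adj G v z ≡ b × z ≢ v
  ∈neighbourhood⁻ = ∈select⁻ neighbour?

  ⁅v⁆∪-homogeneous : ∀ {S} → S ⊆ neighbourhood → Homogeneous G b S → Homogeneous G b (⁅ v ⁆ ∪ S)
  ⁅v⁆∪-homogeneous {S} S⊆N S-homogeneous {x} {y} x∈ y∈ x≢y
    with x∈p∪q⁻ ⁅ v ⁆ S x∈ | x∈p∪q⁻ ⁅ v ⁆ S y∈
  ... | inj₁ x∈⁅v⁆ | inj₁ y∈⁅v⁆ =
    contradiction (trans (x∈⁅y⁆⇒x≡y v x∈⁅v⁆) (sym (x∈⁅y⁆⇒x≡y v y∈⁅v⁆))) x≢y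
  ... | inj₁ x∈⁅v⁆ | inj₂ y∈S   rewrite x∈⁅y⁆⇒x≡y v x∈⁅v⁆ = proj₁ (∈neighbourhood⁻ (S⊆N y∈S))
  ... | inj₂ x∈S   | inj₁ y∈⁅v⁆ rewrite x∈⁅y⁆⇒x≡y v y∈⁅v⁆ =
    trans (adj-sym G x v) (proj₁ (∈neighbourhood⁻ (S⊆N x∈S)))
  ... | inj₂ x∈S   | inj₂ y∈S   = S-homogeneous x∈S y∈S x≢y

1+∣N₀∣+∣N₁∣≤n : ∀ {n} (G : Graph n) v →
                1 + (∣ neighbourhood G false v ∣ + ∣ neighbourhood G true v ∣) ≤ n
1+∣N₀∣+∣N₁∣≤n {n} G v = begin
  1 + (∣ N₀ ∣ + ∣ N₁ ∣)   ≡⟨ cong₂ _+_ (∣⁅x⁆∣≡1 v) (disjoint⇒∣p∪q∣≡∣p∣+∣q∣ N₀ N₁ N₀∩N₁=∅) ⟨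
  ∣ ⁅ v ⁆ ∣ + ∣ N₀ ∪ N₁ ∣ ≡⟨ disjoint⇒∣p∪q∣≡∣p∣+∣q∣ ⁅ v ⁆ (N₀ ∪ N₁) ⁅v⁆∩N=∅ ⟨
  ∣ ⁅ v ⁆ ∪ N₀ ∪ N₁ ∣     ≤⟨ ∣p∣≤n (⁅ v ⁆ ∪ N₀ ∪ N₁) ⟩
  n                       ∎
  where
  open ≤-Reasoning
  N₀ N₁ : Subset n
  N₀ = neighbourhood G false v
  N₁ = neighbourhood G true v

  N₀∩N₁=∅ : Disjoint N₀ N₁
  N₀∩N₁=∅ z∈N₀ z∈N₁ =
    Bool.not-¬ (proj₁ (∈neighbourhood⁻ G true v z∈N₁)) (proj₁ (∈neighbourhood⁻ G false v z∈N₀))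

  ⁅v⁆∩N=∅ : Disjoint ⁅ v ⁆ (N₀ ∪ N₁)
  ⁅v⁆∩N=∅ z∈⁅v⁆ z∈N with x∈p∪q⁻ N₀ N₁ z∈N
  ... | inj₁ z∈N₀ = proj₂ (∈neighbourhood⁻ G false v z∈N₀) (x∈⁅y⁆⇒x≡y v z∈⁅v⁆)
  ... | inj₂ z∈N₁ = proj₂ (∈neighbourhood⁻ G true v z∈N₁) (x∈⁅y⁆⇒x≡y v z∈⁅v⁆)

record CommonHomogeneousSet {n} (G : Graph n) (b : Bool) (k : ℕ) (u w : Fin n) : Set where
  field
    members     : Subset n
    large       : k ≤ ∣ members ∣
    homogeneous : Homogeneous G b members
    ⊆N[u]       : members ⊆ neighbourhood G b u
    ⊆N[w]       : members ⊆ neighbourhood G b w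

samePair? : ∀ {n} (x y u w : Fin n) → Dec (SamePair x y u w)
samePair? x y u w = (x ≟ u ×-dec y ≟ w) ⊎-dec (x ≟ w ×-dec y ≟ u)

samePair-swap : ∀ {n} {x y u w : Fin n} → SamePair x y u w → SamePair y x u w
samePair-swap (inj₁ (x≡u , y≡w)) = inj₂ (y≡w , x≡u)
samePair-swap (inj₂ (x≡w , y≡u)) = inj₁ (y≡u , x≡w)

setPair : ∀ {n} (G : Graph n) (u w : Fin n) → u ≢ w → Bool → Graph n
setPair {n} G u w u≢w b = record { adj = adj′ ; sym = adj′-sym ; irrefl = adj′-irrefl }
  where
  adj′ : Fin n → Fin n → Bool
  adj′ x y = if does (samePair? x y u w) then b else adj G x y

  adj′-sym : ∀ x y → adj′ x y ≡ adj′ y x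
  adj′-sym x y = cong₂ (if_then b else_)
    (does-⇔ (mk⇔ samePair-swap samePair-swap) (samePair? x y u w) (samePair? y x u w))
    (adj-sym G x y)

  ¬samePair : ∀ x → ¬ SamePair x x u w
  ¬samePair x (inj₁ (x≡u , x≡w)) = u≢w (trans (sym x≡u) x≡w)
  ¬samePair x (inj₂ (x≡w , x≡u)) = u≢w (trans (sym x≡u) x≡w)

  adj′-irrefl : ∀ x → adj′ x x ≡ false
  adj′-irrefl x = trans
    (cong (if_then b else adj G x x) (dec-false (samePair? x x u w) (¬samePair x)))
    (irrefl G x)

setPair-Flip : ∀ {n} (G : Graph n) u w (u≢w : u ≢ w) b → Flip G (setPair G u w u≢w b) u w b
setPair-Flip G u w u≢w b =
  cong (if_then b else adj G u w) (dec-true (samePair? u w u w) (inj₁ (refl , refl))) ,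
  λ x y ¬same → cong (if_then b else adj G x y) (dec-false (samePair? x y u w) ¬same)

module FlipProperties {n} {G H : Graph n} {u w : Fin n} {b : Bool} (flipped : Flip G H u w b) where

  Flip-reflects-homogeneous : ∀ {c S} → ¬ (u ∈ S × w ∈ S) → Homogeneous H c S → Homogeneous G c S
  Flip-reflects-homogeneous ¬uw∈S S-homogeneous {x} {y} x∈S y∈S x≢y with samePair? x y u w
  ... | yes (inj₁ (refl , refl)) = contradiction (x∈S , y∈S) ¬uw∈S
  ... | yes (inj₂ (refl , refl)) = contradiction (y∈S , x∈S) ¬uw∈S
  ... | no ¬same = trans (sym (proj₂ flipped x y ¬same)) (S-homogeneous x∈S y∈S x≢y)

  Flip-reflects-opposite : u ≢ w → ∀ {S} → Homogeneous H (not b) S → Homogeneous G (not b) S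
  Flip-reflects-opposite u≢w S-homogeneous = Flip-reflects-homogeneous
    (λ (u∈S , w∈S) → Bool.not-¬ (proj₁ flipped) (S-homogeneous u∈S w∈S u≢w)) S-homogeneous

  Flip-new-homogeneous : ∀ {S} → Homogeneous H b S → ¬ Homogeneous G b S → u ∈ S × w ∈ S
  Flip-new-homogeneous {S} S-homogeneous ¬G-homogeneous =
    decidable-stable (u ∈? S ×-dec w ∈? S) λ ¬uw∈S →
      ¬G-homogeneous (Flip-reflects-homogeneous ¬uw∈S S-homogeneous)

  Flip-common-neighbourhood : ∀ {k S} → k ≤ ∣ S ∣ → Homogeneous H b S → u ∈ S → w ∈ S →
                              CommonHomogeneousSet G b (k ∸ 2) u w
  Flip-common-neighbourhood {k} {S} k≤∣S∣ S-homogeneous u∈S w∈S = record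
    { members     = T
    ; large       = large
    ; homogeneous = T-homogeneous
    ; ⊆N[u]       = T⊆N u∈S (proj₁ ∘ proj₂ ∘ ∈T⁻)
    ; ⊆N[w]       = T⊆N w∈S (proj₂ ∘ proj₂ ∘ ∈T⁻)
    }
    where
    T : Subset n
    T = (S ∩ ∁ ⁅ u ⁆) ∩ ∁ ⁅ w ⁆

    ∈T⁻ : ∀ {z} → z ∈ T → z ∈ S × z ≢ u × z ≢ w
    ∈T⁻ z∈T =
      let z∈S∖u , z∉w = x∈p∩q⁻ (S ∩ ∁ ⁅ u ⁆) (∁ ⁅ w ⁆) z∈T
          z∈S , z∉u   = x∈p∩q⁻ S (∁ ⁅ u ⁆) z∈S∖u
      in z∈S , x∉⁅y⁆⇒x≢y (x∈∁p⇒x∉p z∉u) , x∉⁅y⁆⇒x≢y (x∈∁p⇒x∉p z∉w)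

    unchanged : ∀ {x} y → x ∈ T → adj G x y ≡ adj H x y
    unchanged y x∈T with ∈T⁻ x∈T
    ... | _ , x≢u , x≢w = sym (proj₂ flipped _ y [ x≢u ∘ proj₁ , x≢w ∘ proj₁ ]′)

    T-homogeneous : Homogeneous G b T
    T-homogeneous x∈T y∈T x≢y =
      trans (unchanged _ x∈T) (S-homogeneous (proj₁ (∈T⁻ x∈T)) (proj₁ (∈T⁻ y∈T)) x≢y)

    T⊆N : ∀ {v} → v ∈ S → (∀ {z} → z ∈ T → z ≢ v) → T ⊆ neighbourhood G b v
    T⊆N {v} v∈S T∌v {z} z∈T = ∈neighbourhood⁺ G b v vz≡b (T∌v z∈T)
      where
      vz≡b : adj G v z ≡ b
      vz≡b = trans (adj-sym G v z)
        (trans (unchanged v z∈T) (S-homogeneous (proj₁ (∈T⁻ z∈T)) v∈S (T∌v z∈T)))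

    large : k ∸ 2 ≤ ∣ T ∣
    large = ∸-monoˡ-≤ 2 (begin
      k                               ≤⟨ k≤∣S∣ ⟩
      ∣ S ∣                           ≤⟨ ∣p∣≤1+∣p∩∁⁅x⁆∣ S u ⟩
      1 + ∣ S ∩ ∁ ⁅ u ⁆ ∣             ≤⟨ +-monoʳ-≤ 1 (∣p∣≤1+∣p∩∁⁅x⁆∣ (S ∩ ∁ ⁅ u ⁆) w) ⟩
      2 + ∣ T ∣                       ∎)
      where open ≤-Reasoning

module DoublySaturatedGraph {s t n} {G : Graph n} (3≤s : 3 ≤ s) (3≤t : 3 ≤ t)
  (ds : DoublySaturated s t G) where

  open DoublySaturated ds

  forbidden : Bool → ℕ
  forbidden true  = s
  forbidden false = t

  3≤forbidden : ∀ b → 3 ≤ forbidden b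
  3≤forbidden true  = 3≤s
  3≤forbidden false = 3≤t

  noHomogeneousSet : ∀ b → ¬ HomogeneousSet G b (forbidden b)
  noHomogeneousSet true  = proj₁ good ∘ homogeneousSet⇒hasHomogeneous G true
  noHomogeneousSet false = proj₂ good ∘ homogeneousSet⇒hasHomogeneous G false

  setPair-¬RGood : ∀ b {u w} (u≢w : u ≢ w) → adj G u w ≡ not b → ¬ RGood s t (setPair G u w u≢w b)
  setPair-¬RGood true  u≢w uw≡false =
    addSat _ _ u≢w uw≡false (setPair G _ _ u≢w true) (setPair-Flip G _ _ u≢w true)
  setPair-¬RGood false u≢w uw≡true  =
    removeSat _ _ uw≡true (setPair G _ _ u≢w false) (setPair-Flip G _ _ u≢w false)

  ¬RGood⇒hasHomogeneous : ∀ {H : Graph n} b → ¬ RGood s t H →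
    ¬ HasHomogeneous H (not b) (forbidden (not b)) → HasHomogeneous H b (forbidden b)
  ¬RGood⇒hasHomogeneous {H} true ¬good ¬indep =
    decidable-stable (hasHomogeneous? H true s) λ ¬clique → ¬good (¬clique , ¬indep)
  ¬RGood⇒hasHomogeneous {H} false ¬good ¬clique =
    decidable-stable (hasHomogeneous? H false t) λ ¬indep → ¬good (¬clique , ¬indep)

  common-neighbourhood : ∀ b {u w} → u ≢ w → adj G u w ≡ not b →
                         CommonHomogeneousSet G b (forbidden b ∸ 2) u w
  common-neighbourhood b {u} {w} u≢w uw≡¬b =
    let S , k≤∣S∣ , S-homogeneous = hasHomogeneous⇒homogeneousSet H b
          (¬RGood⇒hasHomogeneous {H = H} b (setPair-¬RGood b u≢w uw≡¬b) ¬opposite)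
        u∈S , w∈S = Flip-new-homogeneous S-homogeneous λ G-homogeneous →
          noHomogeneousSet b (S , k≤∣S∣ , G-homogeneous)
    in Flip-common-neighbourhood k≤∣S∣ S-homogeneous u∈S w∈S
    where
    H : Graph n
    H = setPair G u w u≢w b
    open FlipProperties {G = G} {H = H} (setPair-Flip G u w u≢w b)

    ¬opposite : ¬ HasHomogeneous H (not b) (forbidden (not b))
    ¬opposite hom =
      let S , k≤∣S∣ , S-homogeneous = hasHomogeneous⇒homogeneousSet H (not b) hom
      in noHomogeneousSet (not b) (S , k≤∣S∣ , Flip-reflects-opposite u≢w S-homogeneous)

  neighbourhood-bound : ∀ b v {S} → S ⊆ neighbourhood G b v → Homogeneous G b S →
                        ∣ S ∣ ≤ forbidden b ∸ 2
  neighbourhood-bound b v {S} S⊆N S-homogeneous = ∸-monoˡ-≤ 2 (≰⇒> λ f≤1+∣S∣ →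
    noHomogeneousSet b (⁅ v ⁆ ∪ S , subst (forbidden b ≤_) (sym ∣⁅v⁆∪S∣≡1+∣S∣) f≤1+∣S∣ ,
                        ⁅v⁆∪-homogeneous G b v S⊆N S-homogeneous))
    where
    ∣⁅v⁆∪S∣≡1+∣S∣ : ∣ ⁅ v ⁆ ∪ S ∣ ≡ 1 + ∣ S ∣
    ∣⁅v⁆∪S∣≡1+∣S∣ = trans (disjoint⇒∣p∪q∣≡∣p∣+∣q∣ ⁅ v ⁆ S λ v∈⁅v⁆ v∈S →
                               proj₂ (∈neighbourhood⁻ G b v (S⊆N v∈S)) (x∈⁅y⁆⇒x≡y v v∈⁅v⁆))
                           (cong (_+ ∣ S ∣) (∣⁅x⁆∣≡1 v))

  opposite-neighbour : ∀ b {v z} → z ∈ neighbourhood G b v →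
                       ∃ λ w → w ∈ neighbourhood G (not b) v × adj G w z ≡ not b
  opposite-neighbour b {v} {z} z∈N =
    let vz≡b , z≢v = ∈neighbourhood⁻ G b v z∈N
        T = common-neighbourhood (not b) (z≢v ∘ sym) (trans vz≡b (sym (Bool.not-involutive b)))
        open CommonHomogeneousSet T
        w , w∈T = 0<∣p∣⇒Nonempty members (≤-trans (∸-monoˡ-≤ 2 (3≤forbidden (not b))) large)
    in w , ⊆N[u] w∈T ,
       trans (adj-sym G w z) (proj₁ (∈neighbourhood⁻ G (not b) z (⊆N[w] w∈T)))

  neighbourhood-large : ∀ b {v x₀} → x₀ ∈ neighbourhood G (not b) v →
                        2 * (forbidden b ∸ 2) ≤ ∣ neighbourhood G b v ∣
  neighbourhood-large b {v} {x₀} x₀∈N̄ = begin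
    2 * (forbidden b ∸ 2)  ≤⟨ hajnal maximum ⟩
    ∣ ⋂ Ts ∣ + ∣ ⋃ Ts ∣    ≡⟨ cong (_+ ∣ ⋃ Ts ∣) (Empty⇒∣p∣≡0 ⋂Ts-empty) ⟩
    ∣ ⋃ Ts ∣               ≤⟨ p⊆q⇒∣p∣≤∣q∣ (⋃-⊆ (All.map proj₁ maximum)) ⟩
    ∣ N ∣                  ∎
    where
    open ≤-Reasoning
    N N̄ : Subset n
    N = neighbourhood G b v
    N̄ = neighbourhood G (not b) v
    open Hajnal G b N (forbidden b ∸ 2) (neighbourhood-bound b v)

    chosen : ∀ {x} → x ∈ N̄ → ∃ λ T → Maximum T × T ⊆ neighbourhood G b x
    chosen x∈N̄ =
      let vx≡¬b , x≢v = ∈neighbourhood⁻ G (not b) v x∈N̄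
          open CommonHomogeneousSet (common-neighbourhood b (x≢v ∘ sym) vx≡¬b)
      in members , (⊆N[u] , homogeneous , large) , ⊆N[w]

    -- Vertices outside N̄ get a dummy copy of the set chosen for x₀.
    choice : ∀ x → ∃ λ T → Maximum T × (x ∈ N̄ → T ⊆ neighbourhood G b x)
    choice x with x ∈? N̄
    ... | yes x∈N̄ = let T , T-maximum , T⊆Nx = chosen x∈N̄ in T , T-maximum , λ _ → T⊆Nx
    ... | no  x∉N̄ =
      let T , T-maximum , _ = chosen x₀∈N̄ in T , T-maximum , λ x∈N̄ → contradiction x∈N̄ x∉N̄

    T : Fin n → Subset n
    T = proj₁ ∘ choice

    Ts : List (Subset n)
    Ts = map T (x₀ ∷ allFin n)

    maximum : All Maximum Ts
    maximum = All.map⁺ (All.universal (proj₁ ∘ proj₂ ∘ choice) (x₀ ∷ allFin n))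

    ⋂Ts-empty : Empty (⋂ Ts)
    ⋂Ts-empty (z , z∈⋂Ts) =
      let z∈T : All (λ x → z ∈ T x) (x₀ ∷ allFin n)
          z∈T = All.map⁻ (∈⋂⁻ Ts z∈⋂Ts)
          w , w∈N̄ , wz≡¬b = opposite-neighbour b (proj₁ (All.head maximum) (All.head z∈T))
          z∈Tw = All.lookup z∈T (Any.there (∈-allFin w))
      in Bool.not-¬ (proj₁ (∈neighbourhood⁻ G b w (proj₂ (proj₂ (choice w)) w∈N̄ z∈Tw))) wz≡¬b

  nonEdge⇒order-bound : ∀ {u w} → u ≢ w → adj G u w ≡ false →
                        1 + (2 * (t ∸ 2) + 2 * (s ∸ 2)) ≤ n
  nonEdge⇒order-bound {u} u≢w uw≡false =
    let w∈N₀ = ∈neighbourhood⁺ G false u uw≡false (u≢w ∘ sym)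
        _ , x∈N₁ , _ = opposite-neighbour false w∈N₀
    in ≤-trans
         (+-monoʳ-≤ 1 (+-mono-≤ (neighbourhood-large false x∈N₁) (neighbourhood-large true w∈N₀)))
         (1+∣N₀∣+∣N₁∣≤n G u)

2s+2t∸7≡1+2[t∸2]+2[s∸2] : ∀ {s t} → 3 ≤ s → 3 ≤ t →
                          2 * s + 2 * t ∸ 7 ≡ 1 + (2 * (t ∸ 2) + 2 * (s ∸ 2))
2s+2t∸7≡1+2[t∸2]+2[s∸2] {suc (suc s)} {suc (suc t)} (s≤s (s≤s _)) (s≤s (s≤s _)) =
  trans (cong (_∸ 7) (expand s t)) (m+n∸m≡n 7 _)
  where
  expand : ∀ s t → 2 * (2 + s) + 2 * (2 + t) ≡ 7 + (1 + (2 * t + 2 * s))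
  expand = solve-∀

mainTheorem2 : ∀ (s t : ℕ) → 3 ≤ s → 3 ≤ t →
    ∀ (n : ℕ) (G : Graph n) → DoublySaturated s t G →
    2 * s + 2 * t ∸ 7 ≤ n
mainTheorem2 s t 3≤s 3≤t n G ds = decidable-stable (2 * s + 2 * t ∸ 7 ≤? n) λ ¬bound →
  DoublySaturated.notComplete ds λ u w u≢w → Bool.¬-not λ uw≡false →
    ¬bound (subst (_≤ n) (sym (2s+2t∸7≡1+2[t∸2]+2[s∸2] 3≤s 3≤t))
                  (nonEdge⇒order-bound u≢w uw≡false))
  where open DoublySaturatedGraph 3≤s 3≤t ds
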